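{- Let $\mathcal{L}=(\Sigma,R)$ be a finitely nested $\lambda$-TRS. Then for every closed term $s$ over $\Sigma$, the normal form $[\![s]\!]$ of $\mathit{exp}_0(s)$ is a finite closed term over $\Sigma_\lambda$, hence a $\lambda$-term representation (of the $\lambda$-term it denotes).
   Context: A $\lambda$-TRS is a pair $\mathcal{L}=(\Sigma,R)$ where $\Sigma$ is a signature containing the binary application symbol $@$; the symbols in $\Sigma^-:=\Sigma\setminus\{@\}$ are called scope symbols, and $R$ contains, for each scope symbol $f$ of arity $k$, exactly one (defining) rule $@(f(x_1,\dots,x_k),y)\to F(x_1,\dots,x_k,y)$, where $F$ is a $(k+1)$-ary context over $\Sigma$, the scope context of $f$. A scope symbol $f$ depends on $g$ if $g$ occurs in the scope context of $f$; $\mathcal{L}$ is finitely nested if there is no infinite chain $f_0,f_1,f_2,\dots$ of scope symbols with each $f_m$ depending on $f_{m+1}$. $\Sigma_\lambda$ consists of the constants $v_j$ ($j\in\mathbb{N}$), the binary symbol $@$, and unary named-abstraction symbols $\lambda v_j$ ($j\in\mathbb{N}$); a $\lambda$-term representation is a closed (finite) term over $\Sigma_\lambda$, read as a $\lambda$-term in the obvious way. The expansion TRS for $\mathcal{L}$ has signature $\Sigma\cup\Sigma_\lambda\cup\{\mathit{exp}_i : i\in\mathbb{N}\}$ ($\mathit{exp}_i$ unary, and $\Sigma^-$ disjoint from the other symbols) and rules $\mathit{exp}_i(@(x_1,x_2))\to @(\mathit{exp}_i(x_1),\mathit{exp}_i(x_2))$; $\mathit{exp}_i(f(x_1,\dots,x_k))\to\lambda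 v_i(\mathit{exp}_{i+1}(F(x_1,\dots,x_k,v_i)))$ for each scope symbol $f$ with scope context $F$; $\mathit{exp}_i(v_j)\to v_j$. It is orthogonal, and $[\![s]\!]$ denotes the unique finite or infinite normal form of $\mathit{exp}_0(s)$. -}

module Defs where

open import Data.Nat using (ℕ; zero; suc)
open import Data.Fin using (Fin; _≟_)
open import Relation.Nullary using (yes; no)
open import Data.Sum using (_⊎_; inj₁; inj₂)
open import Data.Unit using (⊤; tt)
open import Data.Product using (Σ; ∃; ∃-syntax; _×_; _,_)
open import Relation.Nullary using (¬_)
open import Relation.Binary.Construct.Closure.ReflexiveTransitive using (Star)
open import Induction.WellFounded using (WellFounded)

-- Signatures Σ = Σ⁻ ∪ {@}: a (possibly infinite) type of scope symbols
-- with arities; the binary application symbol @ is built in.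

record Signature : Set₁ where
  field
    Sym   : Set
    arity : Sym → ℕ
open Signature public

data STm (Sg : Signature) (V : Set) : Set where
  var : V → STm Sg V
  app : STm Sg V → STm Sg V → STm Sg V
  sym : (f : Sym Sg) → (Fin (arity Sg f) → STm Sg V) → STm Sg V

ClosedTerm : Signature → Set
ClosedTerm Sg = STm Sg (Fin 0)

-- λ-TRS: each scope symbol f of arity k has exactly one defining rule
--   @(f(x₁,…,xₖ), y) → F(x₁,…,xₖ,y)
-- given by its scope context F, a term over Σ in the k+1 variables
-- x₁..xₖ (inj₁ i) and y (inj₂ tt).

record LambdaTRS : Set₁ where
  field
    sig : Signature
    ctx : (f : Sym sig) → STm sig (Fin (arity sig f) ⊎ ⊤)
open LambdaTRS public

data Occurs {Sg : Signature} {V : Set} (g : Sym Sg) : STm Sg V → Set where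
  here  : ∀ {ts} → Occurs g (sym g ts)
  inArg : ∀ {f ts} (i : Fin (arity Sg f)) → Occurs g (ts i) → Occurs g (sym f ts)
  inL   : ∀ {a b} → Occurs g a → Occurs g (app a b)
  inR   : ∀ {a b} → Occurs g b → Occurs g (app a b)

Depends : (L : LambdaTRS) → Sym (sig L) → Sym (sig L) → Set
Depends L f g = Occurs g (ctx L f)

FinitelyNestedChain : LambdaTRS → Set
FinitelyNestedChain L =
  ¬ (Σ (ℕ → Sym (sig L)) λ c → ∀ m → Depends L (c m) (c (suc m)))

-- Constructive rendering used in the statement: the converse of the
-- dependency relation is well-founded (no infinite chain, constructively).
FinitelyNested : LambdaTRS → Set
FinitelyNested L = WellFounded (λ g f → Depends L f g)

-- Terms of the expansion TRS: signature Σ ∪ Σ_λ ∪ {expᵢ}.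
-- Only ground terms are needed (rewriting of closed terms).

data ETm (Sg : Signature) : Set where
  app : ETm Sg → ETm Sg → ETm Sg
  sym : (f : Sym Sg) → (Fin (arity Sg f) → ETm Sg) → ETm Sg
  v   : ℕ → ETm Sg
  lam : ℕ → ETm Sg → ETm Sg
  exp : ℕ → ETm Sg → ETm Sg

inst : ∀ {Sg V} → STm Sg V → (V → ETm Sg) → ETm Sg
inst (var x)    σ = σ x
inst (app a b)  σ = app (inst a σ) (inst b σ)
inst (sym f ts) σ = sym f (λ i → inst (ts i) σ)

embed : ∀ {Sg} → ClosedTerm Sg → ETm Sg
embed s = inst s (λ ())

data RootStep (L : LambdaTRS) : ETm (sig L) → ETm (sig L) → Set where
  exp-app : ∀ i a b → RootStep L (exp i (app a b)) (app (exp i a) (exp i b))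
  exp-sym : ∀ i f ts →
    RootStep L (exp i (sym f ts))
      (lam i (exp (suc i) (inst (ctx L f) λ { (inj₁ k) → ts k ; (inj₂ tt) → v i })))
  exp-v   : ∀ i j → RootStep L (exp i (v j)) (v j)

update : ∀ {A : Set} {k} → (Fin k → A) → Fin k → A → Fin k → A
update ts i t′ j with j ≟ i
... | yes _ = t′
... | no  _ = ts j

data Step (L : LambdaTRS) : ETm (sig L) → ETm (sig L) → Set where
  root : ∀ {a b} → RootStep L a b → Step L a b
  appL : ∀ {a a′ b} → Step L a a′ → Step L (app a b) (app a′ b)
  appR : ∀ {a b b′} → Step L b b′ → Step L (app a b) (app a b′)
  symA : ∀ {f ts} (i : Fin (arity (sig L) f)) {t′} → Step L (ts i) t′ →
         Step L (sym f ts) (sym f (update ts i t′))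
  lamS : ∀ {j a a′} → Step L a a′ → Step L (lam j a) (lam j a′)
  expS : ∀ {i a a′} → Step L a a′ → Step L (exp i a) (exp i a′)

_⟶*_ : ∀ {L : LambdaTRS} → ETm (sig L) → ETm (sig L) → Set
_⟶*_ {L} = Star (Step L)

NormalForm : (L : LambdaTRS) → ETm (sig L) → Set
NormalForm L t = ∀ {u} → ¬ Step L t u

data LamRep : Set where
  v   : ℕ → LamRep
  app : LamRep → LamRep → LamRep
  lam : ℕ → LamRep → LamRep

⌜_⌝ : ∀ {Sg} → LamRep → ETm Sg
⌜ v j ⌝     = v j
⌜ app a b ⌝ = app ⌜ a ⌝ ⌜ b ⌝
⌜ lam j a ⌝ = lam j ⌜ a ⌝

-- Expansion normalises by well-founded induction along the dependency order.
-- Call t expandable if every expᵢ(t) reduces to a λ-term representation. Instantiating a context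
-- with expandable terms gives an expandable term provided every scope symbol
-- occurring in the context is expandable at all arguments; and expᵢ(f(t⃗))
-- unfolds to λvᵢ(expᵢ₊₁(F(t⃗,vᵢ))), where F only mentions symbols below f.
module Submission where

open import Defs
open import Data.Nat using (suc)
open import Data.Sum using (inj₁; inj₂)
open import Data.Unit using (tt)
open import Data.Product using (Σ; ∃-syntax; _×_; _,_)
open import Relation.Binary.Construct.Closure.ReflexiveTransitive
  using (ε; _◅_; _◅◅_; gmap)
open import Induction.WellFounded using (Acc; acc)

⌜⌝-normal : (L : LambdaTRS) (r : LamRep) → NormalForm L ⌜ r ⌝
⌜⌝-normal L (app a b) (appL s) = ⌜⌝-normal L a s
⌜⌝-normal L (app a b) (appR s) = ⌜⌝-normal L b s
⌜⌝-normal L (lam j a) (lamS s) = ⌜⌝-normal L a s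
⌜⌝-normal L (v j)     (root ())
⌜⌝-normal L (app a b) (root ())
⌜⌝-normal L (lam j a) (root ())

module _ (L : LambdaTRS) where

  Expandable : ETm (sig L) → Set
  Expandable t = ∀ i → ∃[ r ] _⟶*_ {L} (exp i t) ⌜ r ⌝

  ExpandableSym : Sym (sig L) → Set
  ExpandableSym f = ∀ ts → (∀ k → Expandable (ts k)) → Expandable (sym f ts)

  v-expandable : ∀ j → Expandable (v j)
  v-expandable j i = v j , root (exp-v i j) ◅ ε

  app-expandable : ∀ {a b} → Expandable a → Expandable b → Expandable (app a b)
  app-expandable {a} {b} ea eb i with ea i | eb i
  ... | ra , a⟶*ra | rb , b⟶*rb =
    app ra rb ,
    root (exp-app i a b) ◅
      gmap (λ x → app x (exp i b)) appL a⟶*ra ◅◅ gmap (app ⌜ ra ⌝) appR b⟶*rb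

  inst-expandable : ∀ {W} (c : STm (sig L) W) (σ : W → ETm (sig L)) →
    (∀ g → Occurs g c → ExpandableSym g) → (∀ x → Expandable (σ x)) →
    Expandable (inst c σ)
  inst-expandable (var x)    σ ec eσ = eσ x
  inst-expandable (app a b)  σ ec eσ =
    app-expandable (inst-expandable a σ (λ g o → ec g (inL o)) eσ)
                   (inst-expandable b σ (λ g o → ec g (inR o)) eσ)
  inst-expandable (sym f ts) σ ec eσ =
    ec f here (λ k → inst (ts k) σ)
      (λ k → inst-expandable (ts k) σ (λ g o → ec g (inArg k o)) eσ)

  expands-under-λ : ∀ {i t X} → RootStep L (exp i t) (lam i (exp (suc i) X)) →
    Expandable X → ∃[ r ] _⟶*_ {L} (exp i t) ⌜ r ⌝
  expands-under-λ {i} step eX with eX (suc i)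
  ... | r , X⟶*r = lam i r , root step ◅ gmap (lam i) lamS X⟶*r

  acc⇒expandableSym : ∀ f → Acc (λ g f → Depends L f g) f → ExpandableSym f
  -- The substitution is left to unification: it must be the very extended
  -- lambda of the exp-sym rule, which a literal copy here would not be.
  acc⇒expandableSym f (acc below) ts ets i =
    expands-under-λ (exp-sym i f ts)
      (inst-expandable (ctx L f) _ (λ g o → acc⇒expandableSym g (below o))
        λ { (inj₁ k) → ets k ; (inj₂ tt) → v-expandable i })

proposition2p8 : (L : LambdaTRS) → FinitelyNested L →
    (s : ClosedTerm (sig L)) →
    Σ LamRep (λ t → _⟶*_ {L} (exp 0 (embed s)) ⌜ t ⌝ × NormalForm L ⌜ t ⌝)
proposition2p8 L wf s
  with inst-expandable L s (λ ()) (λ f _ → acc⇒expandableSym L f (wf f)) (λ ()) 0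
... | r , exp₀s⟶*r = r , exp₀s⟶*r , ⌜⌝-normal L r
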